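{- Let $G$ be a connected graph of order $n\geq 2$ with maximum degree $\Delta(G)$. Then $\operatorname{ZIR}(G)\leq \frac{\Delta(G)}{\Delta(G)+1}n$, and this bound is sharp (equality holds for some such graph).
   Context: A fort is a nonempty $F\subseteq V(G)$ such that every $v\notin F$ has $|F\cap N(v)|\neq 1$. For $S\subseteq V(G)$, $x\in S$, a private fort of $x$ relative to $S$ is a fort $F$ with $S\cap F=\{x\}$; $S$ is a ZIr-set if every element has a private fort. $\operatorname{ZIR}(G)$ is the maximum cardinality of an inclusion-maximal ZIr-set of $G$. -}

module Defs where

open import Data.Nat using (ℕ; _⊔_)
open import Data.Bool using (Bool; true; false)
open import Data.Fin using (Fin)
open import Data.Fin.Subset using (Subset; _∈_; _∉_; _⊂_; _∩_; ∣_∣; Nonempty)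
open import Data.Vec using (tabulate)
open import Data.List using (List; foldr; map; allFin)
open import Data.Product using (_×_)
open import Relation.Nullary using (¬_)
open import Relation.Binary.PropositionalEquality using (_≡_; _≢_)

record Graph (n : ℕ) : Set where
  field
    adj    : Fin n → Fin n → Bool
    sym    : ∀ u v → adj u v ≡ adj v u
    irrefl : ∀ v → adj v v ≡ false
open Graph public

module _ {n : ℕ} (G : Graph n) where

  N : Fin n → Subset n
  N v = tabulate (adj G v)

  degree : Fin n → ℕ
  degree v = ∣ N v ∣

  -- maximum degree Δ(G) (0 for the empty graph)
  Δ : ℕ
  Δ = foldr _⊔_ 0 (map degree (allFin n))

  data Reach : Fin n → Fin n → Set where
    here : ∀ {v} → Reach v v
    step : ∀ {u v w} → adj G u v ≡ true → Reach v w → Reach u w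

  Connected : Set
  Connected = ∀ u v → Reach u v

  IsFort : Subset n → Set
  IsFort F = Nonempty F × (∀ v → v ∉ F → ∣ F ∩ N v ∣ ≢ 1)

  IsPrivateFort : Subset n → Fin n → Subset n → Set
  IsPrivateFort S x F = IsFort F × (x ∈ S × x ∈ F) × (∀ y → y ∈ S → y ∈ F → y ≡ x)

  IsZIrSet : Subset n → Set
  IsZIrSet S = ∀ x → x ∈ S → Data.Product.∃ (IsPrivateFort S x)

  IsMaximalZIrSet : Subset n → Set
  IsMaximalZIrSet S = IsZIrSet S × (∀ T → S ⊂ T → ¬ IsZIrSet T)

{-# OPTIONS --safe #-}
-- In a connected graph with n ≥ 2, every x in a ZIr-set S has a neighbour outside S:
-- x has some neighbour u, and if all of N(x) lay in S, then N(x) would meet the private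
-- fort F of u exactly in u while x ∉ F, violating the fort condition at x.  Charging every
-- vertex of S to such an outside neighbour charges at most Δ vertices to each vertex of
-- V ∖ S, so |S| ≤ Δ (n − |S|).  The triangle K₃ with S two
-- of its vertices attains the bound.
module Submission where

open import Defs hiding (sym)
open import Data.Nat using (ℕ; _≤_; _*_; suc; zero; _+_; _⊔_; z≤n; s≤s)
open import Data.Nat.Properties
  using (+-*-semiring; ≤-trans; m≤m⊔n; m≤n⊔m; m≤m+n; m≤n+m; +-mono-≤; +-monoˡ-≤;
         *-monoʳ-≤; *-suc; *-distribʳ-+; *-comm; +-comm; m+[n∸m]≡n; module ≤-Reasoning)
open import Data.Fin using (Fin; zero; suc; _≟_)
open import Data.Fin.Subset using (Subset; inside; outside; ∣_∣; _∈_; _∉_; _∩_; ∁; ⁅_⁆; _⊆_; _⊂_; Nonempty)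
open import Data.Fin.Subset.Properties
  using (_∈?_; nonempty?; x∈p∩q⁺; x∈p∩q⁻; ⊆-antisym; x∈⁅x⁆; x∈⁅y⁆⇒x≡y; ∣⁅x⁆∣≡1; ∣p∣≤n; ∣∁p∣≡n∸∣p∣; x∉∁p⇒x∈p)
open import Data.Product using (Σ; ∃; _×_; _,_)
open import Data.Bool using (Bool; true; not)
open import Data.Vec using ([]; _∷_; here; there)
open import Data.Vec.Properties using ([]=⇒lookup; lookup⇒[]=; lookup∘tabulate)
open import Data.Vec.Functional using (Vector)
open import Data.List using (List; foldr; _∷_)
open import Data.List.Membership.Propositional using () renaming (_∈_ to _∈ˡ_)
open import Data.List.Membership.Propositional.Properties using (∈-map⁺; ∈-allFin)
open import Data.List.Relation.Unary.Any using (here; there)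
open import Function using (_∘_)
open import Relation.Nullary using (¬_; yes; no; does; contradiction)
open import Relation.Nullary.Decidable using (dec-true; dec-false)
open import Relation.Binary.PropositionalEquality using (_≡_; _≢_; refl; sym; trans; cong; cong₂; subst)
open import Algebra.Properties.Semiring.Sum +-*-semiring
  using (sum; sum-syntax; ∑-comm; sum-cong-≗; *-distribˡ-sum; *-distribʳ-sum)

sum-mono-≤ : ∀ {n} {f g : Vector ℕ n} → (∀ i → f i ≤ g i) → sum f ≤ sum g
sum-mono-≤ {zero}  f≤g = z≤n
sum-mono-≤ {suc n} f≤g = +-mono-≤ (f≤g zero) (sum-mono-≤ (f≤g ∘ suc))

f[i]≤sum : ∀ {n} (f : Vector ℕ n) i → f i ≤ sum f
f[i]≤sum f zero    = m≤m+n (f zero) _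
f[i]≤sum f (suc i) = ≤-trans (f[i]≤sum (f ∘ suc) i) (m≤n+m _ (f zero))

χ : ∀ {n} → Subset n → Fin n → ℕ
χ (_       ∷ p) (suc i) = χ p i
χ (inside  ∷ _) zero    = 1
χ (outside ∷ _) zero    = 0

χ-∈ : ∀ {n} {p : Subset n} {i} → i ∈ p → χ p i ≡ 1
χ-∈ here        = refl
χ-∈ (there i∈p) = χ-∈ i∈p

χ-∉ : ∀ {n} {p : Subset n} {i} → i ∉ p → χ p i ≡ 0
χ-∉ {p = outside ∷ p} {zero}  i∉p = refl
χ-∉ {p = inside  ∷ p} {zero}  i∉p = contradiction here i∉p
χ-∉ {p = _       ∷ p} {suc i} i∉p = χ-∉ (i∉p ∘ there)

∣p∣≡∑χ : ∀ {n} (p : Subset n) → ∣ p ∣ ≡ sum (χ p)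
∣p∣≡∑χ []            = refl
∣p∣≡∑χ (inside  ∷ p) = cong suc (∣p∣≡∑χ p)
∣p∣≡∑χ (outside ∷ p) = ∣p∣≡∑χ p

∣p∣+∣∁p∣≡n : ∀ {n} (p : Subset n) → ∣ p ∣ + ∣ ∁ p ∣ ≡ n
∣p∣+∣∁p∣≡n p = trans (cong (∣ p ∣ +_) (∣∁p∣≡n∸∣p∣ p)) (m+[n∸m]≡n (∣p∣≤n p))

p⊈q⇒p∩∁q-nonempty : ∀ {n} {p q : Subset n} → ¬ p ⊆ q → Nonempty (p ∩ ∁ q)
p⊈q⇒p∩∁q-nonempty {p = p} {q} p⊈q with nonempty? (p ∩ ∁ q)
... | yes ne   = ne
... | no empty = contradiction (λ {x} x∈p → x∉∁p⇒x∈p (λ x∈∁q → empty (x , x∈p∩q⁺ (x∈p , x∈∁q)))) p⊈q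

covered⇒∣A∣≤∣B∣*d : ∀ {m n} (A : Subset n) (B : Subset m) (C : Fin m → Subset n) {d : ℕ} →
  (∀ j → ∣ C j ∣ ≤ d) → (∀ {i} → i ∈ A → ∃ λ j → j ∈ B × i ∈ C j) → ∣ A ∣ ≤ ∣ B ∣ * d
covered⇒∣A∣≤∣B∣*d {m} {n} A B C {d} ∣C∣≤d cover = begin
  ∣ A ∣                                      ≡⟨ ∣p∣≡∑χ A ⟩
  ∑[ i < n ] χ A i                           ≤⟨ sum-mono-≤ χA≤ ⟩
  ∑[ i < n ] ∑[ j < m ] (χ B j * χ (C j) i) ≡⟨ ∑-comm (λ i j → χ B j * χ (C j) i) ⟩
  ∑[ j < m ] ∑[ i < n ] (χ B j * χ (C j) i) ≡⟨ sum-cong-≗ (λ j → sym (*-distribˡ-sum (χ B j) (χ (C j)))) ⟩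
  ∑[ j < m ] (χ B j * sum (χ (C j)))       ≡⟨ sum-cong-≗ (λ j → cong (χ B j *_) (sym (∣p∣≡∑χ (C j)))) ⟩
  ∑[ j < m ] (χ B j * ∣ C j ∣)             ≤⟨ sum-mono-≤ (λ j → *-monoʳ-≤ (χ B j) (∣C∣≤d j)) ⟩
  ∑[ j < m ] (χ B j * d)                   ≡⟨ sym (*-distribʳ-sum d (χ B)) ⟩
  sum (χ B) * d                              ≡⟨ cong (_* d) (sym (∣p∣≡∑χ B)) ⟩
  ∣ B ∣ * d                                  ∎
  where
  open ≤-Reasoning
  χA≤ : ∀ i → χ A i ≤ ∑[ j < m ] (χ B j * χ (C j) i)
  χA≤ i with i ∈? A
  ... | no  i∉A = subst (_≤ _) (sym (χ-∉ i∉A)) z≤n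
  ... | yes i∈A with cover i∈A
  ...   | j , j∈B , i∈Cj = begin
    χ A i                    ≡⟨ χ-∈ i∈A ⟩
    1                        ≡⟨ cong₂ _*_ (sym (χ-∈ j∈B)) (sym (χ-∈ i∈Cj)) ⟩
    χ B j * χ (C j) i        ≤⟨ f[i]≤sum (λ k → χ B k * χ (C k) i) j ⟩
    ∑[ k < m ] (χ B k * χ (C k) i) ∎

m≤n*o⇒m*[1+o]≤o*[m+n] : ∀ m n o → m ≤ n * o → m * suc o ≤ o * (m + n)
m≤n*o⇒m*[1+o]≤o*[m+n] m n o m≤n*o = begin
  m * suc o      ≡⟨ *-suc m o ⟩
  m + m * o      ≤⟨ +-monoˡ-≤ (m * o) m≤n*o ⟩
  n * o + m * o  ≡⟨ sym (*-distribʳ-+ o n m) ⟩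
  (n + m) * o    ≡⟨ *-comm (n + m) o ⟩
  o * (n + m)    ≡⟨ cong (o *_) (+-comm n m) ⟩
  o * (m + n)    ∎
  where open ≤-Reasoning

x∈xs⇒x≤foldr-⊔ : ∀ {x : ℕ} {xs : List ℕ} → x ∈ˡ xs → x ≤ foldr _⊔_ 0 xs
x∈xs⇒x≤foldr-⊔ (here refl)        = m≤m⊔n _ _
x∈xs⇒x≤foldr-⊔ {xs = y ∷ _} (there x∈xs) = ≤-trans (x∈xs⇒x≤foldr-⊔ x∈xs) (m≤n⊔m y _)

module _ {n : ℕ} (G : Graph n) where

  degree≤Δ : ∀ v → degree G v ≤ Δ G
  degree≤Δ v = x∈xs⇒x≤foldr-⊔ (∈-map⁺ (degree G) (∈-allFin v))

  adj⇒∈N : ∀ {x y} → adj G x y ≡ true → y ∈ N G x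
  adj⇒∈N {x} {y} xy = lookup⇒[]= y (N G x) (trans (lookup∘tabulate (adj G x) y) xy)

  ∈N⇒adj : ∀ {x y} → y ∈ N G x → adj G x y ≡ true
  ∈N⇒adj {x} {y} y∈Nx = trans (sym (lookup∘tabulate (adj G x) y)) ([]=⇒lookup y∈Nx)

  ∈N-sym : ∀ {x y} → y ∈ N G x → x ∈ N G y
  ∈N-sym {x} {y} y∈Nx = adj⇒∈N (trans (Graph.sym G y x) (∈N⇒adj y∈Nx))

  x∉N[x] : ∀ x → x ∉ N G x
  x∉N[x] x x∈Nx with trans (sym (∈N⇒adj x∈Nx)) (irrefl G x)
  ... | ()

  Reach-≢⇒neighbour : ∀ {x y} → Reach G x y → x ≢ y → Nonempty (N G x)
  Reach-≢⇒neighbour here         x≢x = contradiction refl x≢x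
  Reach-≢⇒neighbour (step xu _) _   = _ , adj⇒∈N xu

  Connected⇒neighbour : 2 ≤ n → Connected G → ∀ x → Nonempty (N G x)
  Connected⇒neighbour (s≤s (s≤s _)) conn zero    = Reach-≢⇒neighbour (conn zero (suc zero)) λ ()
  Connected⇒neighbour (s≤s (s≤s _)) conn (suc x) = Reach-≢⇒neighbour (conn (suc x) zero) λ ()

  ZIr-N⊈ : ∀ {S x u} → IsZIrSet G S → x ∈ S → u ∈ N G x → ¬ N G x ⊆ S
  ZIr-N⊈ {S} {x} {u} zir x∈S u∈Nx Nx⊆S with zir u (Nx⊆S u∈Nx)
  ... | F , (_ , fort) , (_ , u∈F) , only-u = fort x x∉F (trans (cong ∣_∣ F∩Nx≡⁅u⁆) (∣⁅x⁆∣≡1 u))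
    where
    x∉F : x ∉ F
    x∉F x∈F = x∉N[x] x (subst (_∈ N G x) (sym (only-u x x∈S x∈F)) u∈Nx)
    F∩Nx≡⁅u⁆ : F ∩ N G x ≡ ⁅ u ⁆
    F∩Nx≡⁅u⁆ = ⊆-antisym
      (λ {j} j∈F∩Nx → let (j∈F , j∈Nx) = x∈p∩q⁻ F (N G x) j∈F∩Nx in
        subst (_∈ ⁅ u ⁆) (sym (only-u j (Nx⊆S j∈Nx) j∈F)) (x∈⁅x⁆ u))
      (λ {j} j∈⁅u⁆ → subst (_∈ F ∩ N G x) (sym (x∈⁅y⁆⇒x≡y u j∈⁅u⁆)) (x∈p∩q⁺ (u∈F , u∈Nx)))

  ZIr⇒outside-neighbour : 2 ≤ n → Connected G → ∀ {S} → IsZIrSet G S →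
    ∀ {x} → x ∈ S → ∃ λ j → j ∈ ∁ S × x ∈ N G j
  ZIr⇒outside-neighbour 2≤n conn {S} zir {x} x∈S
    with Connected⇒neighbour 2≤n conn x
  ... | u , u∈Nx with p⊈q⇒p∩∁q-nonempty (ZIr-N⊈ zir x∈S u∈Nx)
  ...   | j , j∈Nx∩∁S = let (j∈Nx , j∈∁S) = x∈p∩q⁻ (N G x) (∁ S) j∈Nx∩∁S in j , j∈∁S , ∈N-sym j∈Nx

  ZIr-bound : 2 ≤ n → Connected G → ∀ {S} → IsZIrSet G S → ∣ S ∣ * suc (Δ G) ≤ Δ G * n
  ZIr-bound 2≤n conn {S} zir =
    subst (λ k → ∣ S ∣ * suc (Δ G) ≤ Δ G * k) (∣p∣+∣∁p∣≡n S)
      (m≤n*o⇒m*[1+o]≤o*[m+n] ∣ S ∣ ∣ ∁ S ∣ (Δ G)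
        (covered⇒∣A∣≤∣B∣*d S (∁ S) (N G) degree≤Δ (ZIr⇒outside-neighbour 2≤n conn zir)))

complete : (n : ℕ) → Graph n
complete n = record { adj = distinct ; sym = distinct-sym ; irrefl = λ v → cong not (dec-true (v ≟ v) refl) }
  where
  distinct : Fin n → Fin n → Bool
  distinct u v = not (does (u ≟ v))
  distinct-sym : ∀ u v → distinct u v ≡ distinct v u
  distinct-sym u v with u ≟ v
  ... | yes refl = cong not (sym (dec-true (u ≟ u) refl))
  ... | no  u≢v  = cong not (sym (dec-false (v ≟ u) (u≢v ∘ sym)))

complete-connected : ∀ n → Connected (complete n)
complete-connected n u v with u ≟ v
... | yes refl = here
... | no  u≢v  = step (cong not (dec-false (u ≟ v) u≢v)) here

K₃-S : Subset 3
K₃-S = inside ∷ inside ∷ outside ∷ []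

K₃-S-ZIr : IsZIrSet (complete 3) K₃-S
K₃-S-ZIr zero here = F₀ , fort , (here , here) , λ
    { zero _ _ → refl
    ; (suc zero) _ (there ())
    ; (suc (suc zero)) (there (there ())) _ }
  where
  F₀ : Subset 3
  F₀ = inside ∷ outside ∷ inside ∷ []
  fort : IsFort (complete 3) F₀
  fort = (zero , here) , λ
    { zero v∉F → contradiction here v∉F
    ; (suc zero) _ → λ ()
    ; (suc (suc zero)) v∉F → contradiction (there (there here)) v∉F }
K₃-S-ZIr (suc (suc zero)) (there (there ()))
K₃-S-ZIr (suc zero) (there here) = F₁ , fort , (there here , there here) , λ
    { zero _ ()
    ; (suc zero) _ _ → refl
    ; (suc (suc zero)) (there (there ())) _ }
  where
  F₁ : Subset 3
  F₁ = outside ∷ inside ∷ inside ∷ []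
  fort : IsFort (complete 3) F₁
  fort = (suc zero , there here) , λ
    { zero _ → λ ()
    ; (suc zero) v∉F → contradiction (there here) v∉F
    ; (suc (suc zero)) v∉F → contradiction (there (there here)) v∉F }

K₃-S-maximal : ∀ T → K₃-S ⊂ T → ¬ IsZIrSet (complete 3) T
K₃-S-maximal T (_ , zero , _ , x∉S) _             = contradiction here x∉S
K₃-S-maximal T (_ , suc zero , _ , x∉S) _         = contradiction (there here) x∉S
K₃-S-maximal T (S⊆T , suc (suc zero) , 2∈T , _) zir =
  ZIr-N⊈ (complete 3) zir (S⊆T here) (there here) N₀⊆T
  where
  N₀⊆T : N (complete 3) zero ⊆ T
  N₀⊆T (there here)         = S⊆T (there here)
  N₀⊆T (there (there here)) = 2∈T

proposition4p10 : ((n : ℕ) → 2 ≤ n → (G : Graph n) → Connected G → (S : Subset n) → IsMaximalZIrSet G S → ∣ S ∣ * suc (Δ G) ≤ Δ G * n)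
    × (Σ ℕ λ n → 2 ≤ n × (Σ (Graph n) λ G → Connected G × (Σ (Subset n) λ S → IsMaximalZIrSet G S × ∣ S ∣ * suc (Δ G) ≡ Δ G * n)))
proposition4p10 =
    (λ n 2≤n G conn S (zir , _) → ZIr-bound G 2≤n conn zir)
  , 3 , s≤s (s≤s z≤n) , complete 3 , complete-connected 3 , K₃-S , (K₃-S-ZIr , K₃-S-maximal) , refl
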